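{- Suppose $r,d\in\omega^\omega$ are strictly increasing and $r<^*d$. Let $f\in\omega^\omega$ be defined by $f(n)=d\circ\cdots\circ d(n)$, where the composition is taken $n$ times. Then for all but finitely many $n<\omega$ we have $[f(n),f(n+1))\cap\operatorname{rg}(r)\neq\emptyset$.
   Context: $r<^*d$ means there is $n$ such that $r(k)<d(k)$ for all $k>n$. $\operatorname{rg}(r)$ is the range of $r$. -}

module Defs where

open import Data.Nat using (ℕ; zero; suc; _<_; _≤_)
open import Data.Product using (∃; _×_)

iterate : (ℕ → ℕ) → ℕ → ℕ → ℕ
iterate d zero    x = x
iterate d (suc n) x = d (iterate d n x)

StrictlyIncreasing : (ℕ → ℕ) → Set
StrictlyIncreasing r = ∀ m n → m < n → r m < r n

_<*_ : (ℕ → ℕ) → (ℕ → ℕ) → Set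
r <* d = ∃ λ n → ∀ k → n < k → r k < d k

fIter : (ℕ → ℕ) → ℕ → ℕ
fIter d n = iterate d n n

MeetsRange : (ℕ → ℕ) → ℕ → ℕ → Set
MeetsRange r a b = ∃ λ m → (a ≤ r m) × (r m < b)

{-# OPTIONS --safe #-}
module Submission where

-- The witness in [f(n), f(n+1)) is r(f(n)) itself: f(n) ≤ r(f(n)) because a strictly
-- increasing map is inflationary, r(f(n)) < d(f(n)) once f(n) ≥ n is past the point
-- where r <* d kicks in, and d(f(n)) = dⁿ⁺¹(n) < dⁿ⁺¹(n+1) = f(n+1).

open import Defs
open import Data.Nat using (ℕ; zero; suc; _<_; _≤_; z≤n; s≤s)
open import Data.Nat.Properties using (≤-refl; ≤-trans; <-≤-trans; n<1+n; module ≤-Reasoning)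
open import Data.Product using (∃; _×_; _,_)

strictlyIncreasing⇒inflationary : ∀ {r} → StrictlyIncreasing r → ∀ k → k ≤ r k
strictlyIncreasing⇒inflationary r↑ zero    = z≤n
strictlyIncreasing⇒inflationary r↑ (suc k) =
  <-≤-trans (s≤s (strictlyIncreasing⇒inflationary r↑ k)) (r↑ k (suc k) (n<1+n k))

iterate-inflationary : ∀ {d} → StrictlyIncreasing d → ∀ n x → x ≤ iterate d n x
iterate-inflationary d↑ zero    x = ≤-refl
iterate-inflationary d↑ (suc n) x =
  ≤-trans (iterate-inflationary d↑ n x) (strictlyIncreasing⇒inflationary d↑ _)

iterate-strictlyIncreasing : ∀ {d} → StrictlyIncreasing d → ∀ n → StrictlyIncreasing (iterate d n)
iterate-strictlyIncreasing d↑ zero    x y x<y = x<y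
iterate-strictlyIncreasing d↑ (suc n) x y x<y = d↑ _ _ (iterate-strictlyIncreasing d↑ n x y x<y)

d∘fIter<fIter-suc : ∀ {d} → StrictlyIncreasing d → ∀ n → d (fIter d n) < fIter d (suc n)
d∘fIter<fIter-suc d↑ n = iterate-strictlyIncreasing d↑ (suc n) n (suc n) (n<1+n n)

mainTheorem6 : (r d : ℕ → ℕ) → StrictlyIncreasing r → StrictlyIncreasing d → r <* d →
    ∃ λ N → ∀ n → N < n → MeetsRange r (fIter d n) (fIter d (suc n))
mainTheorem6 r d r↑ d↑ (N , r<d) = N , λ n N<n →
  fIter d n , strictlyIncreasing⇒inflationary r↑ (fIter d n) , r[fn]<f[n+1] n N<n
  where
  open ≤-Reasoning
  r[fn]<f[n+1] : ∀ n → N < n → r (fIter d n) < fIter d (suc n)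
  r[fn]<f[n+1] n N<n = begin-strict
    r (fIter d n)    <⟨ r<d (fIter d n) (<-≤-trans N<n (iterate-inflationary d↑ n n)) ⟩
    d (fIter d n)    <⟨ d∘fIter<fIter-suc d↑ n ⟩
    fIter d (suc n)  ∎
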